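{- Let $\Gamma$ be a distance-regular graph with diameter $d\ge 3$. Let $E$ be a nontrivial minimal idempotent of $\Gamma$ with dual eigenvalues $\{\theta_i^*\}_{i=0}^d$, and let $\beta,\gamma^*\in\mathbb{C}$ satisfy $\theta^*_{i-1}-\beta\theta^*_i+\theta^*_{i+1}=\gamma^*$ for $1\le i\le d-1$. Let $\delta^*$ be the common value (for $1\le i\le d$) of $\theta^{*2}_{i-1}-\beta\theta^*_{i-1}\theta^*_i+\theta^{*2}_i-\gamma^*(\theta^*_{i-1}+\theta^*_i)$. Fix a vertex $x$ and let $A^*=A^*(x)$ be the dual distance matrix corresponding to $E$. Then, with $A$ the adjacency matrix and $[r,s]=rs-sr$, $$0=\bigl[A^*,\;A^{*2}A-\beta A^*AA^*+AA^{*2}-\gamma^*(AA^*+A^*A)-\delta^*A\bigr].$$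
   Context: $\Gamma$ is a finite, undirected, connected graph without loops or multiple edges, with vertex set $X$, path-length distance $\partial$ and diameter $d$; it is distance-regular if for all $0\le h,i,j\le d$ and $x,y\in X$ with $\partial(x,y)=h$, the number of vertices at distance $i$ from $x$ and $j$ from $y$ depends only on $h,i,j$. $A_i$ is the $i$-th distance matrix ($(x,y)$-entry $1$ if $\partial(x,y)=i$, else $0$), and $A=A_1$. The algebra $M=\mathrm{span}\{A_0,\dots,A_d\}$ has a basis of minimal idempotents $E_0,\dots,E_d$ with $E_0=|X|^{ -1}J$, $\sum E_i=I$, $E_iE_j=\delta_{ij}E_i$; $E_0$ is trivial. The dual eigenvalues of a minimal idempotent $E$ are the scalars $\theta_i^*$ with $E=|X|^{ -1}\sum_{i=0}^d\theta_i^*A_i$. For a fixed vertex $x$, the dual distance matrix $A^*(x)$ corresponding to $E$ is the diagonal $X\times X$ matrix with $(y,y)$-entry $|X|E_{xy}$ (equivalently $\theta^*_{\partial(x,y)}$). -}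

module Defs where

open import Level using (Level)
open import Data.Bool using (Bool; true; false; _∧_; _∨_; if_then_else_)
open import Data.Nat using (ℕ; zero; suc; _≤_; _<_; _≡ᵇ_)
open import Data.Fin using (Fin)
open import Data.Product using (Σ; ∃; _×_)
open import Relation.Binary.PropositionalEquality using (_≡_)
open import Relation.Nullary using (¬_)
open import Algebra.Bundles using (CommutativeRing)

anyFin : (n : ℕ) → (Fin n → Bool) → Bool
anyFin zero    p = false
anyFin (suc n) p = p Fin.zero ∨ anyFin n (λ i → p (Fin.suc i))
  where import Data.Fin as Fin

countFin : (n : ℕ) → (Fin n → Bool) → ℕ
countFin zero    p = 0
countFin (suc n) p = (if p Fin.zero then 1 else 0) Data.Nat.+ countFin n (λ i → p (Fin.suc i))
  where import Data.Fin as Fin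
        import Data.Nat

reach : {n : ℕ} → (Fin n → Fin n → Bool) → ℕ → Fin n → Fin n → Bool
reach {n} adj zero    x y = isEq x y
  where
    open import Data.Fin using (_≟_)
    open import Relation.Nullary using (does)
    isEq : Fin n → Fin n → Bool
    isEq a b = does (a ≟ b)
reach {n} adj (suc k) x y = reach adj k x y ∨ anyFin n (λ z → reach adj k x z ∧ adj z y)

search : (ℕ → Bool) → ℕ → ℕ → ℕ
search p k zero       = k
search p k (suc fuel) = if p k then k else search p (suc k) fuel

-- path-length distance ∂(x,y): the least k with a walk of length ≤ k
-- (for a connected graph on n vertices this is found below n)
dist : {n : ℕ} → (Fin n → Fin n → Bool) → Fin n → Fin n → ℕ
dist {n} adj x y = search (λ k → reach adj k x y) 0 n

IsSimple : {n : ℕ} → (Fin n → Fin n → Bool) → Set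
IsSimple {n} adj = (∀ x y → adj x y ≡ adj y x) × (∀ x → adj x x ≡ false)

IsConnected : {n : ℕ} → (Fin n → Fin n → Bool) → Set
IsConnected {n} adj = ∀ x y → reach adj n x y ≡ true

HasDiameter : {n : ℕ} → (Fin n → Fin n → Bool) → ℕ → Set
HasDiameter {n} adj d =
  (∀ x y → dist adj x y ≤ d) × Σ (Fin n) (λ x → Σ (Fin n) (λ y → dist adj x y ≡ d))

IsDistanceRegular : {n : ℕ} → (Fin n → Fin n → Bool) → Set
IsDistanceRegular {n} adj =
  IsSimple adj × IsConnected adj ×
  Σ (ℕ → ℕ → ℕ → ℕ) (λ p → ∀ (h i j : ℕ) (x y : Fin n) → dist adj x y ≡ h →
     countFin n (λ z → (dist adj x z ≡ᵇ i) ∧ (dist adj y z ≡ᵇ j)) ≡ p h i j)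

module MatrixDefs {c ℓ : Level} (R : CommutativeRing c ℓ) where
  open CommutativeRing R renaming (Carrier to K)

  Mat : ℕ → Set c
  Mat n = Fin n → Fin n → K

  sumFin : (n : ℕ) → (Fin n → K) → K
  sumFin zero    f = 0#
  sumFin (suc n) f = f Fin.zero + sumFin n (λ i → f (Fin.suc i))
    where import Data.Fin as Fin

  nat : ℕ → K
  nat zero    = 0#
  nat (suc m) = 1# + nat m

  _⊗_ : {n : ℕ} → Mat n → Mat n → Mat n
  _⊗_ {n} P Q x y = sumFin n (λ z → P x z * Q z y)

  _⊕_ : {n : ℕ} → Mat n → Mat n → Mat n
  (P ⊕ Q) x y = P x y + Q x y

  _⊖_ : {n : ℕ} → Mat n → Mat n → Mat n
  (P ⊖ Q) x y = P x y - Q x y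

  _·_ : {n : ℕ} → K → Mat n → Mat n
  (a · P) x y = a * P x y

  _≋_ : {n : ℕ} → Mat n → Mat n → Set ℓ
  P ≋ Q = ∀ x y → P x y ≈ Q x y

  zeroM : {n : ℕ} → Mat n
  zeroM x y = 0#

  [_,_] : {n : ℕ} → Mat n → Mat n → Mat n
  [ P , Q ] = (P ⊗ Q) ⊖ (Q ⊗ P)

  -- field of characteristic zero (stand-in for ℂ)
  IsCharZeroField : Set (c Level.⊔ ℓ)
  IsCharZeroField =
    (¬ (1# ≈ 0#)) ×
    (∀ a → ¬ (a ≈ 0#) → Σ K (λ b → a * b ≈ 1#)) ×
    (∀ m → ¬ (nat (suc m) ≈ 0#))

  module _ {n : ℕ} (adj : Fin n → Fin n → Bool) where

    adjM : Mat n
    adjM x y = if adj x y then 1# else 0#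

    distM : ℕ → Mat n
    distM i x y = if dist adj x y ≡ᵇ i then 1# else 0#

    -- Bose–Mesner algebra M = span{A_0,...,A_d}; since A_i = 0 for i > d,
    -- membership means: entries depend only on the distance.
    InBM : Mat n → Set (c Level.⊔ ℓ)
    InBM F = Σ (ℕ → K) (λ a → ∀ x y → F x y ≈ a (dist adj x y))

    IsIdempotent : Mat n → Set ℓ
    IsIdempotent F = (F ⊗ F) ≋ F

    IsMinimalIdempotent : Mat n → Set (c Level.⊔ ℓ)
    IsMinimalIdempotent E =
      InBM E × IsIdempotent E × ¬ (E ≋ zeroM) ×
      (∀ F → InBM F → IsIdempotent F → (F ⊗ E) ≋ F → (F ≋ zeroM) Data.Sum.⊎ (F ≋ E))
      where import Data.Sum

    -- E_0 = |X|^{-1} J, characterised by |X| E_0 = J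
    IsTrivialIdempotent : Mat n → Set ℓ
    IsTrivialIdempotent E = ∀ x y → nat n * E x y ≈ 1#

    -- θ* are the dual eigenvalues of E:  E = |X|^{-1} Σ_i θ*_i A_i,
    -- i.e. |X| E_{xy} = θ*_{∂(x,y)}
    HasDualEigenvalues : Mat n → (ℕ → K) → Set ℓ
    HasDualEigenvalues E θs = ∀ x y → nat n * E x y ≈ θs (dist adj x y)

    dualDistM : Mat n → Fin n → Mat n
    dualDistM E x y z = if does (y Data.Fin.≟ z) then nat n * E x y else 0#
      where import Data.Fin
            open import Relation.Nullary using (does)

module Submission where

-- A* = A*(x) is diagonal with (y,y)-entry a_y = θ*_{∂(x,y)}.  For a
-- diagonal D = diag(a) and any matrix Q, the commutator [D, Q] has
-- (y,z)-entry (a_y − a_z)·Q_yz, and every product D^i Q D^j has entry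
-- a_y^i Q_yz a_z^j.  Hence the (y,z)-entry of the bracket is
--   (a_y − a_z) · A_yz · (a_y² − β a_y a_z + a_z² − γ*(a_y + a_z) − δ*).
-- If y, z are not adjacent then A_yz = 0.  If they are adjacent, the
-- distances ∂(x,y), ∂(x,z) are equal or differ by one; in the first case
-- a_y = a_z, in the second the defining identity of δ* kills the last
-- factor.  So only the δ* identity, connectedness, symmetry and the
-- diameter bound are needed.

open import Defs
open import Level using (Level)
open import Data.Bool using (Bool; true; false; _∧_; _∨_; if_then_else_)
open import Data.Bool.Properties using (∨-zeroʳ)
open import Data.Nat using (ℕ; zero; suc; _≤_; z≤n) renaming (_+_ to _+ℕ_)
open import Data.Nat.Properties as ℕ using (≤∧≢⇒<; ≤-antisym; <-cmp)
open import Data.Fin using (Fin; _≟_)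
import Data.Fin as F
open import Data.Fin.Properties using (suc-injective)
open import Data.Product using (_,_)
open import Data.Sum using (_⊎_; inj₁; inj₂)
import Data.Sum as Sum
open import Data.Empty using (⊥-elim)
open import Relation.Nullary using (¬_; does; yes; no; contradiction)
open import Relation.Binary.PropositionalEquality as ≡ using (_≡_; _≢_)
open import Relation.Binary.Definitions using (tri<; tri≈; tri>)
open import Algebra.Bundles using (CommutativeRing)

search-sound : ∀ (p : ℕ → Bool) k fuel → p (k +ℕ fuel) ≡ true → p (search p k fuel) ≡ true
search-sound p k zero h = ≡.subst (λ m → p m ≡ true) (ℕ.+-identityʳ k) h
search-sound p k (suc fuel) h with p k in pk
... | true  = pk
... | false = search-sound p (suc k) fuel (≡.subst (λ m → p m ≡ true) (ℕ.+-suc k fuel) h)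

search-least : ∀ (p : ℕ → Bool) k fuel m → k ≤ m → p m ≡ true → search p k fuel ≤ m
search-least p k zero       m k≤m pm = k≤m
search-least p k (suc fuel) m k≤m pm with p k in pk
... | true  = k≤m
... | false = search-least p (suc k) fuel m (≤∧≢⇒< k≤m k≢m) pm
  where
  k≢m : k ≢ m
  k≢m ≡.refl = contradiction (≡.trans (≡.sym pk) pm) λ ()

anyFin-intro : ∀ n (p : Fin n → Bool) w → p w ≡ true → anyFin n p ≡ true
anyFin-intro (suc n) p F.zero    pw rewrite pw = ≡.refl
anyFin-intro (suc n) p (F.suc w) pw
  rewrite anyFin-intro n (λ i → p (F.suc i)) w pw = ∨-zeroʳ (p F.zero)

data WithinOne (i j : ℕ) : Set where
  equal : i ≡ j     → WithinOne i j
  up    : j ≡ suc i → WithinOne i j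
  down  : i ≡ suc j → WithinOne i j

module _ {n : ℕ} (adj : Fin n → Fin n → Bool) where

  reach-step : ∀ k x y z → reach adj k x y ≡ true → adj y z ≡ true →
               reach adj (suc k) x z ≡ true
  reach-step k x y z xy yz =
    ≡.trans (≡.cong (reach adj k x z ∨_)
                    (anyFin-intro n (λ w → reach adj k x w ∧ adj w z) y
                                  (≡.cong₂ _∧_ xy yz)))
            (∨-zeroʳ (reach adj k x z))

  dist-reach : IsConnected adj → ∀ x y → reach adj (dist adj x y) x y ≡ true
  dist-reach conn x y = search-sound (λ k → reach adj k x y) 0 n (conn x y)

  dist-step : IsConnected adj → ∀ x y z → adj y z ≡ true →
              dist adj x z ≤ suc (dist adj x y)
  dist-step conn x y z yz =
    search-least (λ k → reach adj k x z) 0 n (suc (dist adj x y)) z≤n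
                 (reach-step (dist adj x y) x y z (dist-reach conn x y) yz)

  adjacent-within-one : IsConnected adj → (∀ u v → adj u v ≡ adj v u) →
                        ∀ x y z → adj y z ≡ true →
                        WithinOne (dist adj x y) (dist adj x z)
  adjacent-within-one conn symm x y z yz with <-cmp (dist adj x y) (dist adj x z)
  ... | tri< lt _ _ = up (≤-antisym (dist-step conn x y z yz) lt)
  ... | tri≈ _ eq _ = equal eq
  ... | tri> _ _ gt =
    down (≤-antisym (dist-step conn x z y (≡.trans (symm z y) yz)) gt)

module DiagonalMatrices {c ℓ : Level} (R : CommutativeRing c ℓ) where
  open CommutativeRing R renaming (Carrier to K)
  open MatrixDefs R
  open import Relation.Binary.Reasoning.Setoid setoid
  open import Algebra.Properties.Ring ring using ([y-z]x≈yx-zx)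

  sumFin-zero : ∀ n (f : Fin n → K) → (∀ w → f w ≈ 0#) → sumFin n f ≈ 0#
  sumFin-zero zero    f f≈0 = refl
  sumFin-zero (suc n) f f≈0 =
    trans (+-cong (f≈0 F.zero) (sumFin-zero n (λ i → f (F.suc i)) (λ w → f≈0 (F.suc w))))
          (+-identityʳ 0#)

  sumFin-single : ∀ n (f : Fin n → K) y → (∀ w → w ≢ y → f w ≈ 0#) → sumFin n f ≈ f y
  sumFin-single (suc n) f F.zero    off =
    trans (+-cong refl (sumFin-zero n (λ i → f (F.suc i)) (λ w → off (F.suc w) λ ())))
          (+-identityʳ _)
  sumFin-single (suc n) f (F.suc y) off =
    trans (+-cong (off F.zero λ ())
                  (sumFin-single n (λ i → f (F.suc i)) y
                     (λ w w≢y → off (F.suc w) (λ sw≡sy → w≢y (suc-injective sw≡sy)))))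
          (+-identityˡ _)

  -- The diagonal matrix with diagonal b; A*(x) is diag(y ↦ |X| E_xy) by definition.
  diag : {n : ℕ} → (Fin n → K) → Mat n
  diag b y z = if does (y ≟ z) then b y else 0#

  IsDiagonal : {n : ℕ} → (Fin n → K) → Mat n → Set ℓ
  IsDiagonal b D = ∀ y z → D y z ≈ diag b y z

  diag-on : {n : ℕ} (b : Fin n → K) (y : Fin n) → diag b y y ≈ b y
  diag-on b y with y ≟ y
  ... | yes _  = refl
  ... | no y≢y = ⊥-elim (y≢y ≡.refl)

  diag-off : {n : ℕ} (b : Fin n → K) {y z : Fin n} → y ≢ z → diag b y z ≈ 0#
  diag-off b {y} {z} y≢z with y ≟ z
  ... | yes y≡z = ⊥-elim (y≢z y≡z)
  ... | no _    = refl

  diag-mulˡ : {n : ℕ} {b : Fin n → K} {D : Mat n} → IsDiagonal b D →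
              ∀ Q y z → (D ⊗ Q) y z ≈ b y * Q y z
  diag-mulˡ {n} {b} {D} isD Q y z = begin
    sumFin n (λ w → D y w * Q w z) ≈⟨ sumFin-single n _ y off ⟩
    D y y * Q y z                  ≈⟨ *-cong (trans (isD y y) (diag-on b y)) refl ⟩
    b y * Q y z                    ∎
    where
    off : ∀ w → w ≢ y → D y w * Q w z ≈ 0#
    off w w≢y =
      trans (*-cong (trans (isD y w) (diag-off b (λ y≡w → w≢y (≡.sym y≡w)))) refl) (zeroˡ _)

  diag-mulʳ : {n : ℕ} {b : Fin n → K} {D : Mat n} → IsDiagonal b D →
              ∀ Q y z → (Q ⊗ D) y z ≈ Q y z * b z
  diag-mulʳ {n} {b} {D} isD Q y z = begin
    sumFin n (λ w → Q y w * D w z) ≈⟨ sumFin-single n _ z off ⟩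
    Q y z * D z z                  ≈⟨ *-cong refl (trans (isD z z) (diag-on b z)) ⟩
    Q y z * b z                    ∎
    where
    off : ∀ w → w ≢ z → Q y w * D w z ≈ 0#
    off w w≢z = trans (*-cong refl (trans (isD w z) (diag-off b w≢z))) (zeroʳ _)

  -- diag b is diagonal on the nose; the predicate form lets products of diagonals qualify too.
  diag-isDiagonal : {n : ℕ} (b : Fin n → K) → IsDiagonal b (diag b)
  diag-isDiagonal b y z = refl

  diag-square : {n : ℕ} (b : Fin n → K) → IsDiagonal (λ w → b w * b w) (diag b ⊗ diag b)
  diag-square b y z with y ≟ z
  ... | yes ≡.refl = trans (diag-mulˡ (diag-isDiagonal b) (diag b) y y) (*-cong refl (diag-on b y))
  ... | no y≢z     = trans (diag-mulˡ (diag-isDiagonal b) (diag b) y z)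
                           (trans (*-cong refl (diag-off b y≢z)) (zeroʳ _))

  diag-commutator : {n : ℕ} (b : Fin n → K) (Q : Mat n) (y z : Fin n) →
                    [ diag b , Q ] y z ≈ (b y - b z) * Q y z
  diag-commutator b Q y z = begin
    (diag b ⊗ Q) y z - (Q ⊗ diag b) y z
      ≈⟨ +-cong (diag-mulˡ (diag-isDiagonal b) Q y z)
                (-‿cong (diag-mulʳ (diag-isDiagonal b) Q y z)) ⟩
    b y * Q y z - Q y z * b z ≈⟨ +-cong refl (-‿cong (*-comm (Q y z) (b z))) ⟩
    b y * Q y z - b z * Q y z ≈⟨ sym ([y-z]x≈yx-zx (Q y z) (b y) (b z)) ⟩
    (b y - b z) * Q y z       ∎

  relationM : {n : ℕ} → K → K → K → Mat n → Mat n → Mat n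
  relationM β γ δ D Q =
    (((((D ⊗ D) ⊗ Q) ⊖ (β · ((D ⊗ Q) ⊗ D))) ⊕ (Q ⊗ (D ⊗ D)))
       ⊖ (γ · ((Q ⊗ D) ⊕ (D ⊗ Q)))) ⊖ (δ · Q)

  -- The scalar expression to which relationM reduces entrywise when D is diagonal.
  entry-form : K → K → K → K → K → K → K
  entry-form β γ δ u v t =
    ((((u * u) * t - β * ((u * t) * v)) + t * (v * v)) - γ * (t * v + u * t)) - δ * t

  -- For diagonal D = diag b, each product D^i Q D^j has entry b_y^i Q_yz b_z^j.
  relation-entry : ∀ β γ δ {n} (b : Fin n → K) (Q : Mat n) y z →
                   relationM β γ δ (diag b) Q y z ≈ entry-form β γ δ (b y) (b z) (Q y z)
  relation-entry β γ δ b Q y z =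
    +-cong (+-cong (+-cong (+-cong D²Q (-‿cong (*-cong refl DQD))) QD²)
                   (-‿cong (*-cong refl (+-cong QD DQ))))
           refl
    where
    isD = diag-isDiagonal b
    DQ  = diag-mulˡ isD Q y z
    QD  = diag-mulʳ isD Q y z
    D²Q = diag-mulˡ (diag-square b) Q y z
    QD² = diag-mulʳ (diag-square b) Q y z
    DQD = trans (diag-mulʳ isD (diag b ⊗ Q) y z) (*-cong DQ refl)

module DualForms {c ℓ : Level} (R : CommutativeRing c ℓ) where
  open CommutativeRing R renaming (Carrier to K)
  open DiagonalMatrices R using (entry-form)
  open import Relation.Binary.Reasoning.Setoid setoid
  open import Algebra.Properties.Ring ring using (x≈y⇒x∙y⁻¹≈ε)

  -- u² − βuv + v² − γ(u + v): the paper's δ* equals this form at (θ*_{i−1}, θ*_i).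
  δ-form : K → K → K → K → K
  δ-form β γ u v = (((u * u) - (β * u) * v) + v * v) - γ * (u + v)

  δ-form-cong : ∀ β γ {u u′ v v′} → u ≈ u′ → v ≈ v′ → δ-form β γ u v ≈ δ-form β γ u′ v′
  δ-form-cong β γ u≈ v≈ =
    +-cong (+-cong (+-cong (*-cong u≈ u≈) (-‿cong (*-cong (*-cong refl u≈) v≈))) (*-cong v≈ v≈))
           (-‿cong (*-cong refl (+-cong u≈ v≈)))

  -- The form is symmetric, so the δ* identity also covers decreasing indices.
  δ-form-sym : ∀ β γ u v → δ-form β γ v u ≈ δ-form β γ u v
  δ-form-sym β γ u v = +-cong swap (-‿cong (*-cong refl (+-comm v u)))
    where
    βvu≈βuv : (β * v) * u ≈ (β * u) * v
    βvu≈βuv = trans (*-assoc β v u) (trans (*-cong refl (*-comm v u)) (sym (*-assoc β u v)))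
    swap : ((v * v) - (β * v) * u) + u * u ≈ ((u * u) - (β * u) * v) + v * v
    swap = begin
      ((v * v) - (β * v) * u) + u * u   ≈⟨ +-cong (+-cong refl (-‿cong βvu≈βuv)) refl ⟩
      ((v * v) - (β * u) * v) + u * u   ≈⟨ +-assoc _ _ _ ⟩
      (v * v) + (- ((β * u) * v) + u * u) ≈⟨ +-comm _ _ ⟩
      (- ((β * u) * v) + u * u) + v * v ≈⟨ +-cong (+-comm _ _) refl ⟩
      ((u * u) - (β * u) * v) + v * v   ∎

  within-one-dual : ∀ β γ δ (θs : ℕ → K) d →
    (∀ k → suc k ≤ d → δ-form β γ (θs k) (θs (suc k)) ≈ δ) →
    ∀ {i j} → i ≤ d → j ≤ d → WithinOne i j →
    (θs i ≈ θs j) ⊎ (δ-form β γ (θs i) (θs j) ≈ δ)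
  within-one-dual β γ δ θs d hδ _   _   (equal ≡.refl) = inj₁ refl
  within-one-dual β γ δ θs d hδ _   j≤d (up ≡.refl)    = inj₂ (hδ _ j≤d)
  within-one-dual β γ δ θs d hδ {j = j} i≤d _ (down ≡.refl) =
    inj₂ (trans (δ-form-sym β γ (θs j) (θs (suc j))) (hδ j i≤d))

  sum-vanishes : ∀ {x y} → x ≈ 0# → y ≈ 0# → x + y ≈ 0#
  sum-vanishes x≈0 y≈0 = trans (+-cong x≈0 y≈0) (+-identityʳ 0#)

  difference-vanishes : ∀ {x y} → x ≈ 0# → y ≈ 0# → x - y ≈ 0#
  difference-vanishes x≈0 y≈0 = x≈y⇒x∙y⁻¹≈ε (trans x≈0 (sym y≈0))

  -- Every term of the entry form carries a factor t.
  entry-form-zero : ∀ β γ δ u v → entry-form β γ δ u v 0# ≈ 0#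
  entry-form-zero β γ δ u v =
    difference-vanishes
      (difference-vanishes
        (sum-vanishes (difference-vanishes (zeroʳ (u * u)) βterm) (zeroˡ (v * v)))
        γterm)
      (zeroʳ δ)
    where
    βterm : β * ((u * 0#) * v) ≈ 0#
    βterm = trans (*-cong refl (trans (*-cong (zeroʳ u) refl) (zeroˡ v))) (zeroʳ β)
    γterm : γ * (0# * v + u * 0#) ≈ 0#
    γterm = trans (*-cong refl (sum-vanishes (zeroˡ v) (zeroʳ u))) (zeroʳ γ)

  entry-form-one : ∀ β γ δ u v → entry-form β γ δ u v 1# ≈ δ-form β γ u v - δ
  entry-form-one β γ δ u v =
    +-cong (+-cong (+-cong (+-cong (*-identityʳ (u * u)) (-‿cong βterm)) (*-identityˡ (v * v)))
                   (-‿cong (*-cong refl γterm)))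
           (-‿cong (*-identityʳ δ))
    where
    βterm : β * ((u * 1#) * v) ≈ (β * u) * v
    βterm = trans (*-cong refl (*-cong (*-identityʳ u) refl)) (sym (*-assoc β u v))
    γterm : 1# * v + u * 1# ≈ u + v
    γterm = trans (+-cong (*-identityˡ v) (*-identityʳ u)) (+-comm v u)

  edge-factor-vanishes : ∀ β γ δ (b : Bool) {u v} →
    (b ≡ true → (u ≈ v) ⊎ (δ-form β γ u v ≈ δ)) →
    (u - v) * entry-form β γ δ u v (if b then 1# else 0#) ≈ 0#
  edge-factor-vanishes β γ δ false {u} {v} _ =
    trans (*-cong refl (entry-form-zero β γ δ u v)) (zeroʳ _)
  edge-factor-vanishes β γ δ true {u} {v} edge with edge ≡.refl
  ... | inj₁ u≈v = trans (*-cong (x≈y⇒x∙y⁻¹≈ε u≈v) refl) (zeroˡ _)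
  ... | inj₂ H≈δ =
    trans (*-cong refl (trans (entry-form-one β γ δ u v) (x≈y⇒x∙y⁻¹≈ε H≈δ))) (zeroʳ _)

module DualDistance {c ℓ : Level} (R : CommutativeRing c ℓ) where
  open CommutativeRing R renaming (Carrier to K)
  open MatrixDefs R
  open DualForms R using (δ-form; δ-form-cong; within-one-dual)

  adjacent-dual-entries :
    ∀ {n} (adj : Fin n → Fin n → Bool) → IsConnected adj → (∀ u v → adj u v ≡ adj v u) →
    ∀ d → (∀ u v → dist adj u v ≤ d) →
    ∀ (E : Mat n) θs → HasDualEigenvalues adj E θs →
    ∀ β γ δ → (∀ k → suc k ≤ d → δ-form β γ (θs k) (θs (suc k)) ≈ δ) →
    ∀ x y z → adj y z ≡ true →
    (nat n * E x y ≈ nat n * E x z) ⊎ (δ-form β γ (nat n * E x y) (nat n * E x z) ≈ δ)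
  adjacent-dual-entries adj conn symm d bounded E θs dual β γ δ hδ x y z yz =
    Sum.map (λ θ≈ → trans (dual x y) (trans θ≈ (sym (dual x z))))
            (λ H≈δ → trans (δ-form-cong β γ (dual x y) (dual x z)) H≈δ)
            (within-one-dual β γ δ θs d hδ (bounded x y) (bounded x z)
                             (adjacent-within-one adj conn symm x y z yz))

lemma3p2 : ∀ {c ℓ : Level} (R : CommutativeRing c ℓ) →
  let open CommutativeRing R renaming (Carrier to K)
      open MatrixDefs R
  in IsCharZeroField →
     (n : ℕ) (adj : Fin n → Fin n → Bool) → IsDistanceRegular adj →
     (d : ℕ) → 3 ≤ d → HasDiameter adj d →
     (E : Mat n) → IsMinimalIdempotent adj E → ¬ IsTrivialIdempotent adj E →
     (θs : ℕ → K) → HasDualEigenvalues adj E θs →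
     (β γs : K) →
     (∀ (k : ℕ) → suc (suc k) ≤ d →
        (θs k - β * θs (suc k)) + θs (suc (suc k)) ≈ γs) →
     (δs : K) →
     (∀ (k : ℕ) → suc k ≤ d →
        (((θs k * θs k) - (β * θs k) * θs (suc k)) + θs (suc k) * θs (suc k))
          - γs * (θs k + θs (suc k)) ≈ δs) →
     (x : Fin n) →
     let A  = adjM adj
         As = dualDistM adj E x
     in [ As , (((((As ⊗ As) ⊗ A) ⊖ (β · ((As ⊗ A) ⊗ As))) ⊕ (A ⊗ (As ⊗ As)))
                  ⊖ (γs · ((A ⊗ As) ⊕ (As ⊗ A)))) ⊖ (δs · A) ] ≋ zeroM
lemma3p2 R _ n adj ((symm , _) , conn , _) d _ (bounded , _) E _ _ θs dual β γs _ δs hδ x y z =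
  begin
    [ diag a , relationM β γs δs (diag a) A ] y z
      ≈⟨ diag-commutator a (relationM β γs δs (diag a) A) y z ⟩
    (a y - a z) * relationM β γs δs (diag a) A y z
      ≈⟨ *-cong refl (relation-entry β γs δs a A y z) ⟩
    (a y - a z) * entry-form β γs δs (a y) (a z) (A y z)
      ≈⟨ edge-factor-vanishes β γs δs (adj y z)
           (adjacent-dual-entries adj conn symm d bounded E θs dual β γs δs hδ x y z) ⟩
    0# ∎
  where
  open CommutativeRing R renaming (Carrier to K)
  open MatrixDefs R
  open DiagonalMatrices R
  open DualForms R using (edge-factor-vanishes)
  open DualDistance R using (adjacent-dual-entries)
  open import Relation.Binary.Reasoning.Setoid setoid

  a : Fin n → K
  a w = nat n * E x w

  A : Mat n
  A = adjM adj
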